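{- Let $A\in\mathsf{ASM}_n(2143,3412)$ have exactly three entries equal to $-1$, all lying in row $i$. Then the nonzero entries of row $i$ occupy consecutive (adjacent) columns; i.e. there is no zero entry of row $i$ lying between two nonzero entries of row $i$.
   Context: An alternating sign matrix (ASM) is a square matrix with entries in $\{0,1,-1\}$ such that every row and every column sums to $1$ and the nonzero entries of each row and each column alternate in sign. A permutation $\pi\in S_k$ is identified with the $k\times k$ matrix whose row $i$ has a $1$ in column $\pi(i)$ and $0$ elsewhere. An $n\times n$ ASM $A$ classically contains $\pi\in S_k$ if there are order-preserving injections $f,g:[k]\to[n]$ with $A_{f(i),g(\pi(i))}=1$ for all $i$; otherwise $A$ classically avoids $\pi$. $\mathsf{ASM}_n(2143,3412)$ is the set of $n\times n$ ASMs classically avoiding both $2143$ and $3412$. -}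

module Defs where

open import Data.Nat using (ℕ)
open import Data.Fin using (Fin; zero; suc; _<_)
open import Data.Integer using (ℤ; +_; -[1+_])
open import Data.Product using (Σ; _×_; ∃)
open import Data.Sum using (_⊎_)
open import Relation.Binary.PropositionalEquality using (_≡_; _≢_)
open import Relation.Nullary using (¬_)

Matrix : ℕ → Set
Matrix n = Fin n → Fin n → ℤ

sumFin : {n : ℕ} → (Fin n → ℤ) → ℤ
sumFin {ℕ.zero} v = + 0
sumFin {ℕ.suc n} v = Data.Integer._+_ (v zero) (sumFin (λ j → v (suc j)))

Entries01m1 : {n : ℕ} → (Fin n → ℤ) → Set
Entries01m1 v = ∀ j → (v j ≡ + 0) ⊎ ((v j ≡ + 1) ⊎ (v j ≡ -[1+ 0 ]))

Alternating : {n : ℕ} → (Fin n → ℤ) → Set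
Alternating v = ∀ j l → j < l → v j ≢ + 0 → v l ≢ + 0 →
  (∀ k → j < k → k < l → v k ≡ + 0) →
  Data.Integer._+_ (v j) (v l) ≡ + 0

GoodLine : {n : ℕ} → (Fin n → ℤ) → Set
GoodLine v = Entries01m1 v × (sumFin v ≡ + 1) × Alternating v

row : {n : ℕ} → Matrix n → Fin n → (Fin n → ℤ)
row A i = λ j → A i j

col : {n : ℕ} → Matrix n → Fin n → (Fin n → ℤ)
col A j = λ i → A i j

IsASM : {n : ℕ} → Matrix n → Set
IsASM A = (∀ i → GoodLine (row A i)) × (∀ j → GoodLine (col A j))

StrictMono : {k n : ℕ} → (Fin k → Fin n) → Set
StrictMono f = ∀ a b → a < b → f a < f b

-- Classical containment of a permutation π ∈ S_k (given as Fin k → Fin k,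
-- row a of π has its 1 in column π a).
Contains : {n k : ℕ} → Matrix n → (Fin k → Fin k) → Set
Contains {n} {k} A π =
  Σ (Fin k → Fin n) λ f → Σ (Fin k → Fin n) λ g →
    StrictMono f × StrictMono g × (∀ a → A (f a) (g (π a)) ≡ + 1)

Avoids : {n k : ℕ} → Matrix n → (Fin k → Fin k) → Set
Avoids A π = ¬ Contains A π

-- One-line notation, with values shifted to 0-based Fin 4.
p2143 : Fin 4 → Fin 4
p2143 zero = suc zero
p2143 (suc zero) = zero
p2143 (suc (suc zero)) = suc (suc (suc zero))
p2143 (suc (suc (suc zero))) = suc (suc zero)

p3412 : Fin 4 → Fin 4
p3412 zero = suc (suc zero)
p3412 (suc zero) = suc (suc (suc zero))
p3412 (suc (suc zero)) = zero
p3412 (suc (suc (suc zero))) = suc zero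

InASM-2143-3412 : {n : ℕ} → Matrix n → Set
InASM-2143-3412 A = IsASM A × Avoids A p2143 × Avoids A p3412

ExactlyThreeMinusOnesInRow : {n : ℕ} → Matrix n → Fin n → Set
ExactlyThreeMinusOnesInRow {n} A i =
  (∀ r c → A r c ≡ -[1+ 0 ] → r ≡ i) ×
  Σ (Fin n) λ c₁ → Σ (Fin n) λ c₂ → Σ (Fin n) λ c₃ →
    c₁ < c₂ × c₂ < c₃ ×
    (∀ c → A i c ≡ -[1+ 0 ] → (c ≡ c₁ ⊎ (c ≡ c₂ ⊎ c ≡ c₃))) ×
    (A i c₁ ≡ -[1+ 0 ]) × (A i c₂ ≡ -[1+ 0 ]) × (A i c₃ ≡ -[1+ 0 ])

-- Nonzero entries of every row and column of an ASM begin and end with +1.  So if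
-- the −1's of row i lie in columns c₁ < c₂ < c₃, row i has a +1 in some column
-- a₀ < c₁ and in some column a₄ > c₃, and column cₘ has a +1 in a row uₘ above i and
-- in a row dₘ below i.  The other rows contain no −1, hence exactly one +1, so +1's
-- in different columns outside row i lie in different rows; avoiding 2143 and 3412
-- then forces u₁, u₃ < u₂ and d₂ < d₁, d₃.  A zero of row i in a column k strictly
-- between two nonzero entries of row i would leave the +1 of column k in a row
-- r ≠ i, and wherever r lies relative to i and k relative to the cₘ, that +1 together
-- with this frame forms a 2143 or a 3412.
module Submission where

open import Defs
open import Data.Nat as ℕ using (ℕ; z≤n; s≤s)
open import Data.Fin using (Fin; zero; suc; _<_)
open import Data.Fin.Properties using (<-trans; <-cmp; <⇒≢)
open import Data.Integer using (ℤ; +_; -[1+_]; _+_)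
open import Data.Integer.Properties using (+-identityˡ)
open import Data.Vec.Functional using (_∷_; []; tail)
open import Data.Product using (_×_; _,_; proj₁; proj₂; ∃-syntax)
open import Data.Sum using (_⊎_; inj₁; inj₂; [_,_]′)
open import Data.Empty using (⊥-elim)
open import Function using (_∘_)
open import Relation.Binary.PropositionalEquality
  using (_≡_; _≢_; refl; sym; trans; cong; cong₂; subst)
open import Relation.Binary.Definitions using (tri<; tri≈; tri>)
open import Relation.Nullary using (contradiction)

private
  variable
    n k : ℕ

-1ℤ : ℤ
-1ℤ = -[1+ 0 ]

≡+1⇒≢+0 : {x : ℤ} → x ≡ + 1 → x ≢ + 0
≡+1⇒≢+0 refl ()

>⇒≢ : {x y : Fin n} → y < x → x ≢ y
>⇒≢ y<x = <⇒≢ y<x ∘ sym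

≢⇒<⊎> : {x y : Fin n} → x ≢ y → x < y ⊎ y < x
≢⇒<⊎> {x = x} {y} x≢y with <-cmp x y
... | tri< x<y _ _ = inj₁ x<y
... | tri≈ _ x≡y _ = contradiction x≡y x≢y
... | tri> _ _ y<x = inj₂ y<x

nonzeroOr : ℤ → ℤ → ℤ
nonzeroOr (+ 0) y = y
nonzeroOr x     _ = x

nonzeroOr-cases : ∀ x y → (x ≡ + 0 × nonzeroOr x y ≡ y) ⊎ (x ≢ + 0 × nonzeroOr x y ≡ x)
nonzeroOr-cases (+ 0)       _ = inj₁ (refl , refl)
nonzeroOr-cases (+ ℕ.suc _) _ = inj₂ ((λ ()) , refl)
nonzeroOr-cases -[1+ _ ]    _ = inj₂ ((λ ()) , refl)

-- Both are + 0 on a zero line.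
firstNonzero lastNonzero : (Fin n → ℤ) → ℤ
firstNonzero {ℕ.zero}  v = + 0
firstNonzero {ℕ.suc n} v = nonzeroOr (v zero) (firstNonzero (tail v))
lastNonzero  {ℕ.zero}  v = + 0
lastNonzero  {ℕ.suc n} v = nonzeroOr (lastNonzero (tail v)) (v zero)

firstNonzero-position : (v : Fin n → ℤ) → firstNonzero v ≢ + 0 →
  ∃[ p ] v p ≡ firstNonzero v × (∀ q → q < p → v q ≡ + 0)
firstNonzero-position {ℕ.zero} v f≢0 = contradiction refl f≢0
firstNonzero-position {ℕ.suc n} v f≢0 with nonzeroOr-cases (v zero) (firstNonzero (tail v))
... | inj₂ (_ , f≡v₀) = zero , sym f≡v₀ , λ _ ()
... | inj₁ (v₀≡0 , f≡t) with (p , vp , before) ← firstNonzero-position (tail v) (f≢0 ∘ trans f≡t) =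
  suc p , trans vp (sym f≡t) , λ { zero _ → v₀≡0 ; (suc q) (s≤s q<p) → before q q<p }

lastNonzero≡0⇒≡0 : (v : Fin n → ℤ) → lastNonzero v ≡ + 0 → ∀ q → v q ≡ + 0
lastNonzero≡0⇒≡0 {ℕ.suc n} v l≡0 q with nonzeroOr-cases (lastNonzero (tail v)) (v zero) | q
... | inj₁ (_ , l≡v₀)  | zero   = trans (sym l≡v₀) l≡0
... | inj₁ (t≡0 , _)   | suc q′ = lastNonzero≡0⇒≡0 (tail v) t≡0 q′
... | inj₂ (t≢0 , l≡t) | _      = contradiction (trans (sym l≡t) l≡0) t≢0

lastNonzero-position : (v : Fin n → ℤ) → lastNonzero v ≢ + 0 →
  ∃[ p ] v p ≡ lastNonzero v × (∀ q → p < q → v q ≡ + 0)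
lastNonzero-position {ℕ.zero} v l≢0 = contradiction refl l≢0
lastNonzero-position {ℕ.suc n} v l≢0 with nonzeroOr-cases (lastNonzero (tail v)) (v zero)
... | inj₁ (t≡0 , l≡v₀) =
  zero , sym l≡v₀ , λ { zero () ; (suc q) _ → lastNonzero≡0⇒≡0 (tail v) t≡0 q }
... | inj₂ (t≢0 , l≡t) with (p , vp , after) ← lastNonzero-position (tail v) t≢0 =
  suc p , trans vp (sym l≡t) , λ { zero () ; (suc q) (s≤s p<q) → after q p<q }

-- The possible (first nonzero entry, last nonzero entry, sum) of a {0,±1}-line
-- whose nonzero entries alternate in sign.
data Shape : ℤ → ℤ → ℤ → Set where
  blank     : Shape (+ 0) (+ 0) (+ 0)
  plus      : Shape (+ 1) (+ 1) (+ 1)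
  minus     : Shape -1ℤ -1ℤ -1ℤ
  plusMinus : Shape (+ 1) -1ℤ (+ 0)
  minusPlus : Shape -1ℤ (+ 1) (+ 0)

shape-cons : ∀ {x f l s} → (x ≡ + 0) ⊎ (x ≡ + 1) ⊎ (x ≡ -1ℤ) → Shape f l s →
  (x ≢ + 0 → f ≢ + 0 → x + f ≡ + 0) → Shape (nonzeroOr x f) (nonzeroOr l x) (x + s)
shape-cons (inj₁ refl)        blank     _ = blank
shape-cons (inj₁ refl)        plus      _ = plus
shape-cons (inj₁ refl)        minus     _ = minus
shape-cons (inj₁ refl)        plusMinus _ = plusMinus
shape-cons (inj₁ refl)        minusPlus _ = minusPlus
shape-cons (inj₂ (inj₁ refl)) blank     _ = plus
shape-cons (inj₂ (inj₁ refl)) minus     _ = plusMinus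
shape-cons (inj₂ (inj₁ refl)) minusPlus _ = plus
shape-cons (inj₂ (inj₁ refl)) plus      alt with () ← alt (λ ()) (λ ())
shape-cons (inj₂ (inj₁ refl)) plusMinus alt with () ← alt (λ ()) (λ ())
shape-cons (inj₂ (inj₂ refl)) blank     _ = minus
shape-cons (inj₂ (inj₂ refl)) plus      _ = minusPlus
shape-cons (inj₂ (inj₂ refl)) plusMinus _ = minus
shape-cons (inj₂ (inj₂ refl)) minus     alt with () ← alt (λ ()) (λ ())
shape-cons (inj₂ (inj₂ refl)) minusPlus alt with () ← alt (λ ()) (λ ())

alternating-tail : {v : Fin (ℕ.suc n) → ℤ} → Alternating v → Alternating (tail v)
alternating-tail alt j l j<l vj≢0 vl≢0 between =
  alt (suc j) (suc l) (s≤s j<l) vj≢0 vl≢0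
    λ { zero () ; (suc m) (s≤s j<m) (s≤s m<l) → between m j<m m<l }

alternating-head : {v : Fin (ℕ.suc n) → ℤ} → Alternating v →
  v zero ≢ + 0 → firstNonzero (tail v) ≢ + 0 → v zero + firstNonzero (tail v) ≡ + 0
alternating-head {v = v} alt v₀≢0 f≢0 with (p , vp , before) ← firstNonzero-position (tail v) f≢0 =
  subst (λ f → v zero + f ≡ + 0) vp
    (alt zero (suc p) (s≤s z≤n) v₀≢0 (f≢0 ∘ trans (sym vp))
      λ { zero () ; (suc m) _ (s≤s m<p) → before m m<p })

shape : {v : Fin n → ℤ} → Entries01m1 v → Alternating v →
  Shape (firstNonzero v) (lastNonzero v) (sumFin v)
shape {ℕ.zero}  _   _   = blank
shape {ℕ.suc n} ent alt =
  shape-cons (ent zero) (shape (ent ∘ suc) (alternating-tail alt)) (alternating-head alt)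

goodLine-ends : {v : Fin n → ℤ} → GoodLine v → firstNonzero v ≡ + 1 × lastNonzero v ≡ + 1
goodLine-ends (ent , sum≡1 , alt) = ends (shape ent alt) sum≡1
  where
  ends : ∀ {f l s} → Shape f l s → s ≡ + 1 → f ≡ + 1 × l ≡ + 1
  ends plus _ = refl , refl

goodLine-first-one : {v : Fin n → ℤ} → GoodLine v →
  ∃[ p ] v p ≡ + 1 × (∀ q → q < p → v q ≡ + 0)
goodLine-first-one {v = v} good
  with first≡1 ← proj₁ (goodLine-ends good)
  with (p , vp , before) ← firstNonzero-position v (≡+1⇒≢+0 first≡1) = p , trans vp first≡1 , before

goodLine-last-one : {v : Fin n → ℤ} → GoodLine v →
  ∃[ p ] v p ≡ + 1 × (∀ q → p < q → v q ≡ + 0)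
goodLine-last-one {v = v} good
  with last≡1 ← proj₂ (goodLine-ends good)
  with (p , vp , after) ← lastNonzero-position v (≡+1⇒≢+0 last≡1) = p , trans vp last≡1 , after

goodLine-one : {v : Fin n → ℤ} → GoodLine v → ∃[ p ] v p ≡ + 1
goodLine-one good with (p , vp≡1 , _) ← goodLine-first-one good = p , vp≡1

goodLine-one-before : {v : Fin n → ℤ} {c : Fin n} → GoodLine v → v c ≡ -1ℤ →
  ∃[ j ] j < c × v j ≡ + 1
goodLine-one-before {c = c} good vc≡-1 with goodLine-first-one good
... | p , vp≡1 , before with <-cmp p c
... | tri< p<c _ _ = p , p<c , vp≡1
... | tri≈ _ refl _ with () ← trans (sym vc≡-1) vp≡1
... | tri> _ _ c<p with () ← trans (sym vc≡-1) (before c c<p)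

goodLine-one-after : {v : Fin n → ℤ} {c : Fin n} → GoodLine v → v c ≡ -1ℤ →
  ∃[ l ] c < l × v l ≡ + 1
goodLine-one-after {c = c} good vc≡-1 with goodLine-last-one good
... | p , vp≡1 , after with <-cmp c p
... | tri< c<p _ _ = p , c<p , vp≡1
... | tri≈ _ refl _ with () ← trans (sym vc≡-1) vp≡1
... | tri> _ _ p<c with () ← trans (sym vc≡-1) (after c p<c)

record Flanked (v : Fin n → ℤ) (c : Fin n) : Set where
  field
    before     : Fin n
    before<c   : before < c
    one-before : v before ≡ + 1
    after      : Fin n
    c<after    : c < after
    one-after  : v after ≡ + 1

goodLine-flanked : {v : Fin n → ℤ} {c : Fin n} → GoodLine v → v c ≡ -1ℤ → Flanked v c
goodLine-flanked good vc≡-1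
  with (j , j<c , vj≡1) ← goodLine-one-before good vc≡-1
     | (l , c<l , vl≡1) ← goodLine-one-after good vc≡-1 =
  record { before = j ; before<c = j<c ; one-before = vj≡1
         ; after  = l ; c<after  = c<l ; one-after  = vl≡1 }

nonzero-entry : {v : Fin n → ℤ} → Entries01m1 v → ∀ j → v j ≢ + 0 → v j ≢ -1ℤ → v j ≡ + 1
nonzero-entry ent j vj≢0 vj≢-1 with ent j
... | inj₁ vj≡0         = contradiction vj≡0 vj≢0
... | inj₂ (inj₁ vj≡1)  = vj≡1
... | inj₂ (inj₂ vj≡-1) = contradiction vj≡-1 vj≢-1

ZeroOne : (Fin n → ℤ) → Set
ZeroOne v = ∀ j → v j ≡ + 0 ⊎ v j ≡ + 1

entries-without-minus-one : {v : Fin n → ℤ} → Entries01m1 v → (∀ j → v j ≢ -1ℤ) → ZeroOne v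
entries-without-minus-one ent no-1 j with ent j
... | inj₁ vj≡0         = inj₁ vj≡0
... | inj₂ (inj₁ vj≡1)  = inj₂ vj≡1
... | inj₂ (inj₂ vj≡-1) = contradiction vj≡-1 (no-1 j)

zeroOne-sumFin : (v : Fin n → ℤ) → ZeroOne v → ∃[ m ] sumFin v ≡ + m
zeroOne-sumFin {ℕ.zero}  v _  = 0 , refl
zeroOne-sumFin {ℕ.suc n} v z01 with zeroOne-sumFin (tail v) (z01 ∘ suc) | z01 zero
... | m , t≡m | inj₁ v₀≡0 rewrite t≡m | v₀≡0 = m , refl
... | m , t≡m | inj₂ v₀≡1 rewrite t≡m | v₀≡1 = ℕ.suc m , refl

zeroOne-sumFin-positive : (v : Fin n → ℤ) → ZeroOne v → ∀ {y} → v y ≡ + 1 →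
  ∃[ m ] sumFin v ≡ + ℕ.suc m
zeroOne-sumFin-positive v z01 {zero} v₀≡1 with zeroOne-sumFin (tail v) (z01 ∘ suc)
... | m , t≡m rewrite t≡m | v₀≡1 = m , refl
zeroOne-sumFin-positive v z01 {suc y} vy≡1
  with zeroOne-sumFin-positive (tail v) (z01 ∘ suc) vy≡1 | z01 zero
... | m , t≡m | inj₁ v₀≡0 rewrite t≡m | v₀≡0 = m , refl
... | m , t≡m | inj₂ v₀≡1 rewrite t≡m | v₀≡1 = ℕ.suc m , refl

zeroOne-sumFin≡1-head : (v : Fin (ℕ.suc n) → ℤ) → ZeroOne v → sumFin v ≡ + 1 →
  v zero ≡ + 1 → ∀ {y} → v (suc y) ≢ + 1
zeroOne-sumFin≡1-head v z01 sum≡1 v₀≡1 vy≡1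
  with m , t≡m ← zeroOne-sumFin-positive (tail v) (z01 ∘ suc) vy≡1
  with () ← trans (sym (cong₂ _+_ v₀≡1 t≡m)) sum≡1

zeroOne-sumFin≡1-unique : (v : Fin n → ℤ) → ZeroOne v → sumFin v ≡ + 1 →
  ∀ {x y} → v x ≡ + 1 → v y ≡ + 1 → x ≡ y
zeroOne-sumFin≡1-unique v z01 sum≡1 {zero}  {zero}  _    _    = refl
zeroOne-sumFin≡1-unique v z01 sum≡1 {zero}  {suc y} v₀≡1 vy≡1 =
  contradiction vy≡1 (zeroOne-sumFin≡1-head v z01 sum≡1 v₀≡1)
zeroOne-sumFin≡1-unique v z01 sum≡1 {suc x} {zero}  vx≡1 v₀≡1 =
  contradiction vx≡1 (zeroOne-sumFin≡1-head v z01 sum≡1 v₀≡1)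
zeroOne-sumFin≡1-unique v z01 sum≡1 {suc x} {suc y} vx≡1 vy≡1 with z01 zero
... | inj₂ v₀≡1 = contradiction vx≡1 (zeroOne-sumFin≡1-head v z01 sum≡1 v₀≡1)
... | inj₁ v₀≡0 = cong suc (zeroOne-sumFin≡1-unique (tail v) (z01 ∘ suc) tail≡1 vx≡1 vy≡1)
  where
  tail≡1 : sumFin (tail v) ≡ + 1
  tail≡1 = trans (sym (+-identityˡ _)) (subst (λ a → a + sumFin (tail v) ≡ + 1) v₀≡0 sum≡1)

∷-strictMono : {a : Fin n} {f : Fin (ℕ.suc k) → Fin n} →
  a < f zero → StrictMono f → StrictMono (a ∷ f)
∷-strictMono a<f₀ f↑ zero    (suc zero)    _         = a<f₀
∷-strictMono a<f₀ f↑ zero    (suc (suc b)) _         = <-trans a<f₀ (f↑ zero (suc b) (s≤s z≤n))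
∷-strictMono a<f₀ f↑ (suc a) (suc b)       (s≤s a<b) = f↑ a b a<b

singleton-strictMono : {a : Fin n} → StrictMono (a ∷ [])
singleton-strictMono zero zero ()

quadruple : Fin n → Fin n → Fin n → Fin n → Fin 4 → Fin n
quadruple a b c d = a ∷ b ∷ c ∷ d ∷ []

quadruple-strictMono : {a b c d : Fin n} → a < b → b < c → c < d →
  StrictMono (quadruple a b c d)
quadruple-strictMono a<b b<c c<d =
  ∷-strictMono a<b (∷-strictMono b<c (∷-strictMono c<d singleton-strictMono))

contains-2143 : (A : Matrix n) {x₀ x₁ x₂ x₃ y₀ y₁ y₂ y₃ : Fin n} →
  x₀ < x₁ → x₁ < x₂ → x₂ < x₃ → y₀ < y₁ → y₁ < y₂ → y₂ < y₃ →
  A x₀ y₁ ≡ + 1 → A x₁ y₀ ≡ + 1 → A x₂ y₃ ≡ + 1 → A x₃ y₂ ≡ + 1 → Contains A p2143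
contains-2143 A {x₀} {x₁} {x₂} {x₃} {y₀} {y₁} {y₂} {y₃} x₀₁ x₁₂ x₂₃ y₀₁ y₁₂ y₂₃ e₀ e₁ e₂ e₃ =
  quadruple x₀ x₁ x₂ x₃ , quadruple y₀ y₁ y₂ y₃ ,
  quadruple-strictMono x₀₁ x₁₂ x₂₃ , quadruple-strictMono y₀₁ y₁₂ y₂₃ ,
  λ { zero → e₀ ; (suc zero) → e₁ ; (suc (suc zero)) → e₂ ; (suc (suc (suc zero))) → e₃ }

contains-3412 : (A : Matrix n) {x₀ x₁ x₂ x₃ y₀ y₁ y₂ y₃ : Fin n} →
  x₀ < x₁ → x₁ < x₂ → x₂ < x₃ → y₀ < y₁ → y₁ < y₂ → y₂ < y₃ →
  A x₀ y₂ ≡ + 1 → A x₁ y₃ ≡ + 1 → A x₂ y₀ ≡ + 1 → A x₃ y₁ ≡ + 1 → Contains A p3412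
contains-3412 A {x₀} {x₁} {x₂} {x₃} {y₀} {y₁} {y₂} {y₃} x₀₁ x₁₂ x₂₃ y₀₁ y₁₂ y₂₃ e₀ e₁ e₂ e₃ =
  quadruple x₀ x₁ x₂ x₃ , quadruple y₀ y₁ y₂ y₃ ,
  quadruple-strictMono x₀₁ x₁₂ x₂₃ , quadruple-strictMono y₀₁ y₁₂ y₂₃ ,
  λ { zero → e₀ ; (suc zero) → e₁ ; (suc (suc zero)) → e₂ ; (suc (suc (suc zero))) → e₃ }

module RowWithThreeMinusOnes
  {n : ℕ} {A : Matrix n} {i : Fin n}
  (rows-good : ∀ r → GoodLine (row A r)) (cols-good : ∀ c → GoodLine (col A c))
  (avoids-2143 : Avoids A p2143) (avoids-3412 : Avoids A p3412)
  (minus-one⇒row-i : ∀ r c → A r c ≡ -1ℤ → r ≡ i)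
  {c₁ c₂ c₃ : Fin n} (c₁<c₂ : c₁ < c₂) (c₂<c₃ : c₂ < c₃)
  (minus-one⇒cₘ : ∀ c → A i c ≡ -1ℤ → c ≡ c₁ ⊎ c ≡ c₂ ⊎ c ≡ c₃)
  (Aic₁ : A i c₁ ≡ -1ℤ) (Aic₂ : A i c₂ ≡ -1ℤ) (Aic₃ : A i c₃ ≡ -1ℤ)
  where

  open Flanked (goodLine-flanked (rows-good i) Aic₁)
    renaming (before to a₀; before<c to a₀<c₁; one-before to Aia₀) using ()
  open Flanked (goodLine-flanked (rows-good i) Aic₃)
    renaming (after to a₄; c<after to c₃<a₄; one-after to Aia₄) using ()
  open Flanked (goodLine-flanked (cols-good c₁) Aic₁)
    renaming (before to u₁; before<c to u₁<i; one-before to Au₁c₁;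
              after to d₁; c<after to i<d₁; one-after to Ad₁c₁) using ()
  open Flanked (goodLine-flanked (cols-good c₂) Aic₂)
    renaming (before to u₂; before<c to u₂<i; one-before to Au₂c₂;
              after to d₂; c<after to i<d₂; one-after to Ad₂c₂) using ()
  open Flanked (goodLine-flanked (cols-good c₃) Aic₃)
    renaming (before to u₃; before<c to u₃<i; one-before to Au₃c₃;
              after to d₃; c<after to i<d₃; one-after to Ad₃c₃) using ()

  c₁<c₃ : c₁ < c₃
  c₁<c₃ = <-trans c₁<c₂ c₂<c₃

  one-before-c₁ : ∀ {x} → x < c₁ → A i x ≢ + 0 → A i x ≡ + 1
  one-before-c₁ {x} x<c₁ Aix≢0 = nonzero-entry (proj₁ (rows-good i)) x Aix≢0
    ([ <⇒≢ x<c₁ , [ <⇒≢ (<-trans x<c₁ c₁<c₂) , <⇒≢ (<-trans x<c₁ c₁<c₃) ]′ ]′ ∘ minus-one⇒cₘ x)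

  one-after-c₃ : ∀ {x} → c₃ < x → A i x ≢ + 0 → A i x ≡ + 1
  one-after-c₃ {x} c₃<x Aix≢0 = nonzero-entry (proj₁ (rows-good i)) x Aix≢0
    ([ >⇒≢ (<-trans c₁<c₃ c₃<x) , [ >⇒≢ (<-trans c₂<c₃ c₃<x) , >⇒≢ c₃<x ]′ ]′ ∘ minus-one⇒cₘ x)

  -- Outside row i there are no −1's, so every other row has a single +1.
  rows-of-ones-differ : ∀ {x y p q} → x ≢ i → A x p ≡ + 1 → A y q ≡ + 1 → p < q → x < y ⊎ y < x
  rows-of-ones-differ {x} x≢i Axp Ayq p<q = ≢⇒<⊎> λ { refl → <⇒≢ p<q (single-one Axp Ayq) }
    where
    single-one : ∀ {p q} → A x p ≡ + 1 → A x q ≡ + 1 → p ≡ q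
    single-one = zeroOne-sumFin≡1-unique (row A x)
      (entries-without-minus-one (proj₁ (rows-good x)) (λ c → x≢i ∘ minus-one⇒row-i x c))
      (proj₁ (proj₂ (rows-good x)))

  u₁<u₂ : u₁ < u₂
  u₁<u₂ with rows-of-ones-differ (<⇒≢ u₁<i) Au₁c₁ Au₂c₂ c₁<c₂
  ... | inj₁ u₁<u₂ = u₁<u₂
  ... | inj₂ u₂<u₁ =
    ⊥-elim (avoids-2143 (contains-2143 A u₂<u₁ u₁<i i<d₃ c₁<c₂ c₂<c₃ c₃<a₄ Au₂c₂ Au₁c₁ Aia₄ Ad₃c₃))

  u₃<u₂ : u₃ < u₂
  u₃<u₂ with rows-of-ones-differ (<⇒≢ u₂<i) Au₂c₂ Au₃c₃ c₂<c₃
  ... | inj₂ u₃<u₂ = u₃<u₂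
  ... | inj₁ u₂<u₃ =
    ⊥-elim (avoids-3412 (contains-3412 A u₂<u₃ u₃<i i<d₁ a₀<c₁ c₁<c₂ c₂<c₃ Au₂c₂ Au₃c₃ Aia₀ Ad₁c₁))

  d₂<d₁ : d₂ < d₁
  d₂<d₁ with rows-of-ones-differ (>⇒≢ i<d₁) Ad₁c₁ Ad₂c₂ c₁<c₂
  ... | inj₂ d₂<d₁ = d₂<d₁
  ... | inj₁ d₁<d₂ =
    ⊥-elim (avoids-3412 (contains-3412 A u₃<i i<d₁ d₁<d₂ c₁<c₂ c₂<c₃ c₃<a₄ Au₃c₃ Aia₄ Ad₁c₁ Ad₂c₂))

  d₂<d₃ : d₂ < d₃
  d₂<d₃ with rows-of-ones-differ (>⇒≢ i<d₂) Ad₂c₂ Ad₃c₃ c₂<c₃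
  ... | inj₁ d₂<d₃ = d₂<d₃
  ... | inj₂ d₃<d₂ =
    ⊥-elim (avoids-2143 (contains-2143 A u₁<i i<d₃ d₃<d₂ a₀<c₁ c₁<c₂ c₂<c₃ Au₁c₁ Aia₀ Ad₃c₃ Ad₂c₂))

  no-one-left-of-c₁ : ∀ {j k r} → j < k → k < c₁ → A i j ≡ + 1 → r ≢ i → A r k ≢ + 1
  no-one-left-of-c₁ j<k k<c₁ Aij r≢i Ark with ≢⇒<⊎> r≢i
  ... | inj₁ r<i = avoids-2143 (contains-2143 A r<i i<d₂ d₂<d₁ j<k k<c₁ c₁<c₂ Ark Aij Ad₂c₂ Ad₁c₁)
  ... | inj₂ i<r = avoids-3412 (contains-3412 A u₁<u₂ u₂<i i<r j<k k<c₁ c₁<c₂ Au₁c₁ Au₂c₂ Aij Ark)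

  no-one-between-c₁-c₂ : ∀ {k r} → c₁ < k → k < c₂ → r ≢ i → A r k ≢ + 1
  no-one-between-c₁-c₂ c₁<k k<c₂ r≢i Ark with ≢⇒<⊎> r≢i
  ... | inj₁ r<i with rows-of-ones-differ r≢i Ark Au₂c₂ k<c₂
  ...   | inj₁ r<u₂ = avoids-3412 (contains-3412 A r<u₂ u₂<i i<d₁ a₀<c₁ c₁<k k<c₂ Ark Au₂c₂ Aia₀ Ad₁c₁)
  ...   | inj₂ u₂<r = avoids-2143 (contains-2143 A u₂<r r<i i<d₃ k<c₂ c₂<c₃ c₃<a₄ Au₂c₂ Ark Aia₄ Ad₃c₃)
  no-one-between-c₁-c₂ c₁<k k<c₂ r≢i Ark | inj₂ i<r with rows-of-ones-differ r≢i Ark Ad₂c₂ k<c₂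
  ...   | inj₁ r<d₂ = avoids-3412 (contains-3412 A u₃<i i<r r<d₂ k<c₂ c₂<c₃ c₃<a₄ Au₃c₃ Aia₄ Ark Ad₂c₂)
  ...   | inj₂ d₂<r = avoids-2143 (contains-2143 A u₁<i i<d₂ d₂<r a₀<c₁ c₁<k k<c₂ Au₁c₁ Aia₀ Ad₂c₂ Ark)

  no-one-between-c₂-c₃ : ∀ {k r} → c₂ < k → k < c₃ → r ≢ i → A r k ≢ + 1
  no-one-between-c₂-c₃ c₂<k k<c₃ r≢i Ark with ≢⇒<⊎> r≢i
  ... | inj₁ r<i with rows-of-ones-differ (<⇒≢ u₂<i) Au₂c₂ Ark c₂<k
  ...   | inj₁ u₂<r = avoids-3412 (contains-3412 A u₂<r r<i i<d₁ a₀<c₁ c₁<c₂ c₂<k Au₂c₂ Ark Aia₀ Ad₁c₁)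
  ...   | inj₂ r<u₂ = avoids-2143 (contains-2143 A r<u₂ u₂<i i<d₃ c₂<k k<c₃ c₃<a₄ Ark Au₂c₂ Aia₄ Ad₃c₃)
  no-one-between-c₂-c₃ c₂<k k<c₃ r≢i Ark | inj₂ i<r with rows-of-ones-differ (>⇒≢ i<d₂) Ad₂c₂ Ark c₂<k
  ...   | inj₁ d₂<r = avoids-3412 (contains-3412 A u₃<i i<d₂ d₂<r c₂<k k<c₃ c₃<a₄ Au₃c₃ Aia₄ Ad₂c₂ Ark)
  ...   | inj₂ r<d₂ = avoids-2143 (contains-2143 A u₁<i i<r r<d₂ a₀<c₁ c₁<c₂ c₂<k Au₁c₁ Aia₀ Ark Ad₂c₂)

  no-one-right-of-c₃ : ∀ {k l r} → c₃ < k → k < l → A i l ≡ + 1 → r ≢ i → A r k ≢ + 1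
  no-one-right-of-c₃ c₃<k k<l Ail r≢i Ark with ≢⇒<⊎> r≢i
  ... | inj₁ r<i = avoids-3412 (contains-3412 A r<i i<d₂ d₂<d₃ c₂<c₃ c₃<k k<l Ark Ail Ad₂c₂ Ad₃c₃)
  ... | inj₂ i<r = avoids-2143 (contains-2143 A u₃<u₂ u₂<i i<r c₂<c₃ c₃<k k<l Au₃c₃ Au₂c₂ Ail Ark)

  zero-column≢c : ∀ {k c} → A i k ≡ + 0 → A i c ≡ -1ℤ → k ≢ c
  zero-column≢c Aik≡0 Aic≡-1 refl with () ← trans (sym Aik≡0) Aic≡-1

  one-row≢i : ∀ {r k} → A i k ≡ + 0 → A r k ≡ + 1 → r ≢ i
  one-row≢i Aik≡0 Ark refl with () ← trans (sym Ark) Aik≡0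

  no-zero-between : ∀ j k l → j < k → k < l → A i j ≢ + 0 → A i l ≢ + 0 → A i k ≢ + 0
  no-zero-between j k l j<k k<l Aij≢0 Ail≢0 Aik≡0
    with r , Ark ← goodLine-one (cols-good k)
    with r≢i ← one-row≢i Aik≡0 Ark
    with ≢⇒<⊎> (zero-column≢c Aik≡0 Aic₁)
  ... | inj₁ k<c₁ = no-one-left-of-c₁ j<k k<c₁ (one-before-c₁ (<-trans j<k k<c₁) Aij≢0) r≢i Ark
  ... | inj₂ c₁<k with ≢⇒<⊎> (zero-column≢c Aik≡0 Aic₂)
  ...   | inj₁ k<c₂ = no-one-between-c₁-c₂ c₁<k k<c₂ r≢i Ark
  ...   | inj₂ c₂<k with ≢⇒<⊎> (zero-column≢c Aik≡0 Aic₃)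
  ...     | inj₁ k<c₃ = no-one-between-c₂-c₃ c₂<k k<c₃ r≢i Ark
  ...     | inj₂ c₃<k = no-one-right-of-c₃ c₃<k k<l (one-after-c₃ (<-trans c₃<k k<l) Ail≢0) r≢i Ark

lemma5p5 : (n : ℕ) (A : Matrix n) (i : Fin n) →
    InASM-2143-3412 A → ExactlyThreeMinusOnesInRow A i →
    ∀ j k l → j < k → k < l → A i j ≢ + 0 → A i l ≢ + 0 → A i k ≢ + 0
lemma5p5 n A i ((rows-good , cols-good) , avoids-2143 , avoids-3412)
  (minus-one⇒row-i , c₁ , c₂ , c₃ , c₁<c₂ , c₂<c₃ , minus-one⇒cₘ , Aic₁ , Aic₂ , Aic₃) =
  RowWithThreeMinusOnes.no-zero-between rows-good cols-good avoids-2143 avoids-3412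
    minus-one⇒row-i c₁<c₂ c₂<c₃ minus-one⇒cₘ Aic₁ Aic₂ Aic₃
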